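{- For all $n\ge 5$, $\overline{q}_n(123,321)=0$.
   Context: For a positive integer $n$, let $\mathcal{S}_{n,n}$ denote the set of all permutations (words) $\pi=\pi_1\cdots\pi_{2n}$ of the multiset $\{1,1,2,2,\ldots,n,n\}$. A word $\pi$ contains a pattern $\sigma=\sigma_1\cdots\sigma_k$ if there are indices $i_1<\cdots<i_k$ such that $\pi_{i_a}=\pi_{i_b}$ iff $\sigma_a=\sigma_b$ and $\pi_{i_a}<\pi_{i_b}$ iff $\sigma_a<\sigma_b$ for all $a,b$; otherwise $\pi$ avoids $\sigma$. The quasi-Stirling permutations $\overline{\mathcal{Q}}_n$ are the $\pi\in\mathcal{S}_{n,n}$ avoiding both $1212$ and $2121$. For a set $\Lambda$ of patterns, $\overline{\mathcal{Q}}_n(\Lambda)$ is the set of $\pi\in\overline{\mathcal{Q}}_n$ avoiding every pattern in $\Lambda$, and $\overline{q}_n(\Lambda)=|\overline{\mathcal{Q}}_n(\Lambda)|$. -}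

module Defs where

open import Data.Nat using (ℕ; _*_; _<_)
open import Data.Fin using (Fin; toℕ)
open import Data.Fin.Properties using ()
open import Data.Vec using (Vec; lookup; count; []; _∷_)
open import Data.Product using (Σ; _×_)
open import Function.Bundles using (_⇔_)
open import Relation.Binary.PropositionalEquality using (_≡_)
open import Relation.Nullary using (¬_)
import Data.Fin as F

-- A pattern of length k is a function Fin k → ℕ (its letters).
-- A word of length m over the alphabet Fin n (letter i stands for value i+1).

Contains : ∀ {n m k} → Vec (Fin n) m → Vec ℕ k → Set
Contains {n} {m} {k} π σ =
  Σ (Fin k → Fin m) λ ι →
    (∀ (a b : Fin k) → toℕ a < toℕ b → toℕ (ι a) < toℕ (ι b)) ×
    (∀ (a b : Fin k) →
       ((lookup π (ι a) ≡ lookup π (ι b)) ⇔ (lookup σ a ≡ lookup σ b)) ×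
       ((toℕ (lookup π (ι a)) < toℕ (lookup π (ι b))) ⇔ (lookup σ a < lookup σ b)))

Avoids : ∀ {n m k} → Vec (Fin n) m → Vec ℕ k → Set
Avoids π σ = ¬ Contains π σ

IsPermOfDoubledMultiset : ∀ {n} → Vec (Fin n) (2 * n) → Set
IsPermOfDoubledMultiset {n} π = ∀ (v : Fin n) → count (F._≟ v) π ≡ 2

IsQuasiStirling : ∀ {n} → Vec (Fin n) (2 * n) → Set
IsQuasiStirling π =
  IsPermOfDoubledMultiset π ×
  Avoids π (1 ∷ 2 ∷ 1 ∷ 2 ∷ []) ×
  Avoids π (2 ∷ 1 ∷ 2 ∷ 1 ∷ [])

-- By the multiset condition the letters 1,…,5 all occur in π. Reading one
-- occurrence of each of them in order of the letters gives five distinct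
-- positions, and by Erdős–Szekeres (5 > 2·2) three of them are monotone.
-- An increasing triple of positions spells 123, a decreasing one 321.
module Submission where

open import Defs
open import Level using (Level; 0ℓ)
open import Data.Nat using (ℕ; _≤_; _*_; _<_; z<s; s<s)
open import Data.Nat.Properties using (<-cmp; _≟_; _<?_)
open import Data.Fin using (Fin; inject≤; zero; suc; #_)
import Data.Fin as F
import Data.Fin.Properties as F
open import Data.Vec using (Vec; []; _∷_; lookup; count)
open import Data.Product using (_×_; _,_; ∃-syntax; proj₁; proj₂)
open import Data.Sum using (_⊎_; inj₁; inj₂; swap; [_,_]′)
import Data.Sum as Sum
open import Data.Empty using (⊥-elim)
open import Function using (_∘_; flip; _on_)
open import Function.Bundles using (_⇔_; mk⇔)
open import Function.Definitions using (Injective)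
open import Relation.Binary using (Rel; Transitive; Trichotomous; tri<; tri≈; tri>)
import Relation.Binary.Construct.Flip.EqAndOrd as Flip
open import Relation.Binary.PropositionalEquality using (_≡_; _≢_; sym; cong; subst)
open import Relation.Nullary using (¬_; Dec; yes; no)
open import Relation.Nullary.Decidable using (True; toWitness; _→-dec_)
open import Relation.Unary using (Pred; Decidable)

private
  variable
    a ℓ : Level
    A : Set a

count-pos⇒occurs : ∀ {p} {P : Pred A p} (P? : Decidable P) {m} (xs : Vec A m) →
                   0 < count P? xs → ∃[ i ] P (lookup xs i)
count-pos⇒occurs P? (x ∷ xs) pos with P? x
... | yes px = zero , px
... | no _   with count-pos⇒occurs P? xs pos
...   | i , pi = suc i , pi

decide-Fin² : ∀ {k} {P : Fin k → Fin k → Set} (P? : ∀ i j → Dec (P i j)) →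
              {True (F.all? λ i → F.all? (P? i))} → ∀ i j → P i j
decide-Fin² P? {yes!} = toWitness yes!

lookup₃-mono : {_≺_ : Rel A ℓ} → Transitive _≺_ → ∀ {x y z} → x ≺ y → y ≺ z →
               ∀ {i j : Fin 3} → i F.< j →
               lookup (x ∷ y ∷ z ∷ []) i ≺ lookup (x ∷ y ∷ z ∷ []) j
lookup₃-mono trans x≺y y≺z {zero}          {suc zero}       _ = x≺y
lookup₃-mono trans x≺y y≺z {zero}          {suc (suc zero)} _ = trans x≺y y≺z
lookup₃-mono trans x≺y y≺z {suc zero}      {suc (suc zero)} _ = y≺z
lookup₃-mono _ _ _ {suc zero}       {suc zero}       (s<s ())
lookup₃-mono _ _ _ {suc (suc zero)} {suc zero}       (s<s ())
lookup₃-mono _ _ _ {suc (suc zero)} {suc (suc zero)} (s<s (s<s ()))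

AscendingTriple : Rel A ℓ → ∀ {m} → (Fin m → A) → Set ℓ
AscendingTriple _≺_ x = ∃[ i ] ∃[ j ] ∃[ k ] i F.< j × j F.< k × x i ≺ x j × x j ≺ x k

module _ {_≺_ : Rel A ℓ} (compare : Trichotomous _≡_ _≺_)
         (x : Fin 5 → A) (x-injective : Injective _≡_ _≡_ x) where

  private
    separated : ∀ i j → i ≢ j → x i ≺ x j ⊎ x j ≺ x i
    separated i j i≢j with compare (x i) (x j)
    ... | tri< xi≺xj _ _ = inj₁ xi≺xj
    ... | tri≈ _ xi≡xj _ = ⊥-elim (i≢j (x-injective xi≡xj))
    ... | tri> _ _ xj≺xi = inj₂ xj≺xi

  monotone-triple-after-rise : x (# 0) ≺ x (# 1) →
                               AscendingTriple _≺_ x ⊎ AscendingTriple (flip _≺_) x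
  monotone-triple-after-rise x₀≺x₁ with separated (# 1) (# 2) (λ ())
  ... | inj₁ x₁≺x₂ = inj₁ (# 0 , # 1 , # 2 , z<s , s<s z<s , x₀≺x₁ , x₁≺x₂)
  ... | inj₂ x₂≺x₁ with separated (# 1) (# 3) (λ ())
  ...   | inj₁ x₁≺x₃ = inj₁ (# 0 , # 1 , # 3 , z<s , s<s z<s , x₀≺x₁ , x₁≺x₃)
  ...   | inj₂ x₃≺x₁ with separated (# 2) (# 3) (λ ())
  ...     | inj₂ x₃≺x₂ = inj₂ (# 1 , # 2 , # 3 , s<s z<s , s<s (s<s z<s) , x₂≺x₁ , x₃≺x₂)
  ...     | inj₁ x₂≺x₃ with separated (# 3) (# 4) (λ ())
  ...       | inj₂ x₄≺x₃ = inj₂ (# 1 , # 3 , # 4 , s<s z<s , s<s (s<s (s<s z<s)) , x₃≺x₁ , x₄≺x₃)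
  ...       | inj₁ x₃≺x₄ = inj₁ (# 2 , # 3 , # 4 , s<s (s<s z<s) , s<s (s<s (s<s z<s)) , x₂≺x₃ , x₃≺x₄)

erdős-szekeres-5 : {_≺_ : Rel A ℓ} → Trichotomous _≡_ _≺_ →
                   (x : Fin 5 → A) → Injective _≡_ _≡_ x →
                   AscendingTriple _≺_ x ⊎ AscendingTriple (flip _≺_) x
erdős-szekeres-5 {_≺_ = _≺_} compare x x-injective with compare (x (# 0)) (x (# 1))
... | tri< x₀≺x₁ _ _ = monotone-triple-after-rise compare x x-injective x₀≺x₁
... | tri≈ _ x₀≡x₁ _ with x-injective x₀≡x₁
...   | ()
erdős-szekeres-5 {_≺_ = _≺_} compare x x-injective | tri> _ _ x₁≺x₀ =
  swap (monotone-triple-after-rise (Flip.compare _≺_ compare) x x-injective x₁≺x₀)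

module _ {n m : ℕ} (π : Vec (Fin n) m) where

  contains-by-embedding : ∀ {k} (σ : Vec ℕ k) (ι : Fin k → Fin m) →
    (∀ {i j} → i F.< j → ι i F.< ι j) →
    (∀ {i j} → lookup σ i ≡ lookup σ j → i ≡ j) →
    (∀ {i j} → lookup σ i < lookup σ j → lookup π (ι i) F.< lookup π (ι j)) →
    Contains π σ
  contains-by-embedding σ ι ι-mono σ-injective σ-embeds =
    ι , (λ _ _ → ι-mono) , λ i j → same-letter i j , smaller-letter i j
    where
    same-letter : ∀ i j → (lookup π (ι i) ≡ lookup π (ι j)) ⇔ (lookup σ i ≡ lookup σ j)
    same-letter i j = mk⇔ to (cong (lookup π ∘ ι) ∘ σ-injective)
      where
      to : lookup π (ι i) ≡ lookup π (ι j) → lookup σ i ≡ lookup σ j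
      to πi≡πj with <-cmp (lookup σ i) (lookup σ j)
      ... | tri< σi<σj _ _ = ⊥-elim (F.<-irrefl πi≡πj (σ-embeds σi<σj))
      ... | tri≈ _ σi≡σj _ = σi≡σj
      ... | tri> _ _ σj<σi = ⊥-elim (F.<-irrefl (sym πi≡πj) (σ-embeds σj<σi))

    smaller-letter : ∀ i j → (lookup π (ι i) F.< lookup π (ι j)) ⇔ (lookup σ i < lookup σ j)
    smaller-letter i j = mk⇔ to σ-embeds
      where
      to : lookup π (ι i) F.< lookup π (ι j) → lookup σ i < lookup σ j
      to πi<πj with <-cmp (lookup σ i) (lookup σ j)
      ... | tri< σi<σj _ _ = σi<σj
      ... | tri≈ _ σi≡σj _ = ⊥-elim (F.<-irrefl (cong (lookup π ∘ ι) (σ-injective σi≡σj)) πi<πj)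
      ... | tri> _ _ σj<σi = ⊥-elim (F.<-asym πi<πj (σ-embeds σj<σi))

  private
    _<ᵛ_ : Rel (Fin m) 0ℓ
    _<ᵛ_ = F._<_ on lookup π

  contains-123 : ∀ {i j k} → i F.< j → j F.< k → i <ᵛ j → j <ᵛ k →
                 Contains π (1 ∷ 2 ∷ 3 ∷ [])
  contains-123 {i} {j} {k} i<j j<k i<ᵛj j<ᵛk =
    contains-by-embedding σ (lookup (i ∷ j ∷ k ∷ []))
      (lookup₃-mono {_≺_ = F._<_} F.<-trans i<j j<k)
      (λ {a} {b} → decide-Fin² (λ a b → lookup σ a ≟ lookup σ b →-dec a F.≟ b) a b)
      (λ {a} {b} → lookup₃-mono {_≺_ = _<ᵛ_} F.<-trans i<ᵛj j<ᵛk
                     ∘ decide-Fin² (λ a b → lookup σ a <? lookup σ b →-dec a F.<? b) a b)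
    where
    σ : Vec ℕ 3
    σ = 1 ∷ 2 ∷ 3 ∷ []

  contains-321 : ∀ {i j k} → i F.< j → j F.< k → j <ᵛ i → k <ᵛ j →
                 Contains π (3 ∷ 2 ∷ 1 ∷ [])
  contains-321 {i} {j} {k} i<j j<k j<ᵛi k<ᵛj =
    contains-by-embedding σ (lookup (i ∷ j ∷ k ∷ []))
      (lookup₃-mono {_≺_ = F._<_} F.<-trans i<j j<k)
      (λ {a} {b} → decide-Fin² (λ a b → lookup σ a ≟ lookup σ b →-dec a F.≟ b) a b)
      (λ {a} {b} → lookup₃-mono {_≺_ = flip _<ᵛ_} (flip F.<-trans) j<ᵛi k<ᵛj
                     ∘ decide-Fin² (λ a b → lookup σ a <? lookup σ b →-dec b F.<? a) a b)
    where
    σ : Vec ℕ 3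
    σ = 3 ∷ 2 ∷ 1 ∷ []

  contains-123-or-321 : (p : Fin 5 → Fin m) →
                        (∀ {a b} → a F.< b → p a <ᵛ p b) →
                        Contains π (1 ∷ 2 ∷ 3 ∷ []) ⊎ Contains π (3 ∷ 2 ∷ 1 ∷ [])
  contains-123-or-321 p p-mono =
    Sum.map ascending descending (erdős-szekeres-5 F.<-cmp p p-injective)
    where
    p-injective : Injective _≡_ _≡_ p
    p-injective {a} {b} pa≡pb with F.<-cmp a b
    ... | tri< a<b _ _ = ⊥-elim (F.<-irrefl (cong (lookup π) pa≡pb) (p-mono a<b))
    ... | tri≈ _ a≡b _ = a≡b
    ... | tri> _ _ b<a = ⊥-elim (F.<-irrefl (cong (lookup π) (sym pa≡pb)) (p-mono b<a))

    ascending : AscendingTriple F._<_ p → Contains π (1 ∷ 2 ∷ 3 ∷ [])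
    ascending (a , b , c , a<b , b<c , pa<pb , pb<pc) =
      contains-123 pa<pb pb<pc (p-mono a<b) (p-mono b<c)

    descending : AscendingTriple (flip F._<_) p → Contains π (3 ∷ 2 ∷ 1 ∷ [])
    descending (a , b , c , a<b , b<c , pb<pa , pc<pb) =
      contains-321 pc<pb pb<pa (p-mono b<c) (p-mono a<b)

theorem4p2 : ∀ (n : ℕ) → 5 ≤ n → (π : Vec (Fin n) (2 * n)) →
    ¬ (IsQuasiStirling π × Avoids π (1 ∷ 2 ∷ 3 ∷ []) × Avoids π (3 ∷ 2 ∷ 1 ∷ []))
theorem4p2 n 5≤n π ((twice , _) , avoids-123 , avoids-321) =
  [ avoids-123 , avoids-321 ]′ (contains-123-or-321 π position position-mono)
  where
  letter : Fin 5 → Fin n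
  letter a = inject≤ a 5≤n

  occurrence : ∀ a → ∃[ i ] lookup π i ≡ letter a
  occurrence a = count-pos⇒occurs (F._≟ letter a) π (subst (0 <_) (sym (twice (letter a))) z<s)

  position : Fin 5 → Fin (2 * n)
  position = proj₁ ∘ occurrence

  position-mono : ∀ {a b} → a F.< b → lookup π (position a) F.< lookup π (position b)
  position-mono {a} {b} a<b
    rewrite proj₂ (occurrence a) | proj₂ (occurrence b)
          | F.toℕ-inject≤ a 5≤n | F.toℕ-inject≤ b 5≤n = a<b
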